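{- Let $G=(V,E)$ be a finite simple graph that is 3-balanced, with 3-balanced coloring $\ell:V\to\mathbb{Z}_3$. Then for all $i,j\in\mathbb{Z}_3$ with $i\not\equiv j$, \[ |E_{ij}|=\frac{2|E|}{9} \quad\text{and}\quad |E_{ii}|=\frac{|E|}{9}. \] In particular, $9\mid |E|$.
   Context: For a vertex coloring $\ell:V\to\mathbb{Z}_3$, write $V_i=\ell^{ -1}(i)$ and $E_{ij}=\{vw\in E : \{\ell(v),\ell(w)\}=\{i,j\}\}$ for $i,j\in\mathbb{Z}_3$. A coloring $\ell:V\to\mathbb{Z}_3$ is (neighborhood) 3-balanced if for every vertex $v$ and all $i,j\in\mathbb{Z}_3$, $|N(v)\cap V_i|=|N(v)\cap V_j|$, where $N(v)$ is the open neighborhood of $v$. A graph is 3-balanced if it admits a 3-balanced coloring. -}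

module Defs where

open import Data.Nat using (ℕ; _<?_)
open import Data.Fin using (Fin; toℕ)
open import Data.Bool using (Bool; true; false; T)
open import Data.Product using (Σ; _×_; _,_; proj₁; proj₂)
open import Data.List using (List; length; filter; cartesianProduct; allFin)
open import Relation.Binary.PropositionalEquality using (_≡_)
open import Relation.Nullary using (Dec; ¬_)
open import Relation.Nullary.Decidable using (_×-dec_; _⊎-dec_)
open import Data.Fin.Properties using (_≟_)
open import Data.Bool.Properties using (T?)
open import Data.Sum using (_⊎_)

record SimpleGraph (n : ℕ) : Set where
  field
    adj     : Fin n → Fin n → Bool
    sym     : ∀ u v → adj u v ≡ adj v u
    irrefl  : ∀ v → adj v v ≡ false
open SimpleGraph public

Coloring : ℕ → Set
Coloring n = Fin n → Fin 3

nbrCount : ∀ {n} → SimpleGraph n → Coloring n → Fin n → Fin 3 → ℕ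
nbrCount G ℓ v i =
  length (filter (λ w → T? (adj G v w) ×-dec (ℓ w ≟ i)) (allFin _))

Balanced : ∀ {n} → SimpleGraph n → Coloring n → Set
Balanced G ℓ = ∀ v i j → nbrCount G ℓ v i ≡ nbrCount G ℓ v j

IsBalancedGraph : ∀ {n} → SimpleGraph n → Set
IsBalancedGraph {n} G = Σ (Coloring n) (Balanced G)

-- The edge set E, each edge {u,v} listed once as an ordered pair (u,v) with u < v.
edges : ∀ {n} → SimpleGraph n → List (Fin n × Fin n)
edges {n} G =
  filter (λ p → (toℕ (proj₁ p) <? toℕ (proj₂ p)) ×-dec T? (adj G (proj₁ p) (proj₂ p)))
         (cartesianProduct (allFin n) (allFin n))

numEdges : ∀ {n} → SimpleGraph n → ℕ
numEdges G = length (edges G)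

EndColors : Fin 3 → Fin 3 → Fin 3 → Fin 3 → Set
EndColors a b i j = ((a ≡ i) × (b ≡ j)) ⊎ ((a ≡ j) × (b ≡ i))

numEdgesBetween : ∀ {n} → SimpleGraph n → Coloring n → Fin 3 → Fin 3 → ℕ
numEdgesBetween G ℓ i j =
  length (filter (λ p → dec (ℓ (proj₁ p)) (ℓ (proj₂ p))) (edges G))
  where
  dec : ∀ a b → Dec (EndColors a b i j)
  dec a b = ((a ≟ i) ×-dec (b ≟ j)) ⊎-dec ((a ≟ j) ×-dec (b ≟ i))

-- Let L a b count the edges uv with u < v, ℓ u = a and ℓ v = b. Summing
-- |N(u) ∩ V_b| over u ∈ V_a counts each edge between V_a and V_b once from
-- each end, so it equals L a b + L b a. Balancedness makes this independent
-- of b, and it is symmetric in a and b, hence constant: L a b + L b a = 2h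
-- with h = L 0 0. So |E_ij| = L i j + L j i = 2h for i ≢ j, |E_ii| = L i i = h,
-- and |E| = Σ_ab L a b = 9h.

module Submission where

open import Data.Bool using (T; if_then_else_)
open import Data.Bool.Properties using (T?)
open import Data.Empty using (⊥-elim)
open import Data.Fin using (Fin; zero; suc; toℕ)
open import Data.Fin.Properties using (_≟_; toℕ-injective)
open import Data.List
  using (List; []; _∷_; length; filter; tabulate; cartesianProduct; allFin; map; _++_)
open import Data.List.Properties using (filter-++; length-++; map-tabulate)
open import Data.Nat using (ℕ; zero; suc; _+_; _*_; _<_; _<?_)
open import Data.Nat.Divisibility using (_∣_; divides)
open import Data.Nat.Properties
  using (+-*-semiring; *-commutativeSemigroup; +-comm; +-identityʳ; *-identityʳ; *-comm; *-assoc;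
         *-distribˡ-+; *-distribʳ-+; *-cancelˡ-≡; <-asym; ≮⇒≥; ≤-antisym)
open import Data.Nat.Tactic.RingSolver using (solve-∀)
open import Data.Product using (_×_; _,_; uncurry)
open import Function using (_∘_; id)
open import Level using (Level)
open import Relation.Binary.PropositionalEquality
  using (_≡_; _≢_; refl; sym; trans; cong; cong₂; module ≡-Reasoning)
open import Relation.Nullary using (Dec; yes; no; does; ¬_)
open import Relation.Nullary.Decidable using (_×-dec_; _⊎-dec_)
open import Relation.Unary using (Pred; Decidable)

open import Defs hiding (sym)
open import Algebra.Properties.Semiring.Sum +-*-semiring
  using (sum-syntax; sum-cong-≗; sum-replicate-zero; ∑-comm; ∑-distrib-+; *-distribˡ-sum)
open import Algebra.Properties.CommutativeSemigroup *-commutativeSemigroup using (x∙yz≈y∙xz)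
open ≡-Reasoning

private
  variable
    p q : Level
    P Q : Set p

𝟙 : Dec P → ℕ
𝟙 P? = if does P? then 1 else 0

𝟙-×-dec : (P? : Dec P) (Q? : Dec Q) → 𝟙 (P? ×-dec Q?) ≡ 𝟙 P? * 𝟙 Q?
𝟙-×-dec (yes _) (yes _) = refl
𝟙-×-dec (yes _) (no _)  = refl
𝟙-×-dec (no _)  _       = refl

𝟙-⊎-dec : (P? : Dec P) (Q? : Dec Q) → ¬ (P × Q) → 𝟙 (P? ⊎-dec Q?) ≡ 𝟙 P? + 𝟙 Q?
𝟙-⊎-dec (yes p) (yes q) ¬p×q = ⊥-elim (¬p×q (p , q))
𝟙-⊎-dec (yes _) (no _)  _    = refl
𝟙-⊎-dec (no _)  _       _    = refl

𝟙-⊎-dec-idem : (P? : Dec P) → 𝟙 (P? ⊎-dec P?) ≡ 𝟙 P?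
𝟙-⊎-dec-idem (yes _) = refl
𝟙-⊎-dec-idem (no _)  = refl

∑-𝟙-≟ : ∀ {k} (x : Fin k) → ∑[ a < k ] 𝟙 (x ≟ a) ≡ 1
∑-𝟙-≟ {suc k} zero    = cong suc (sum-replicate-zero k)
∑-𝟙-≟ {suc k} (suc x) = ∑-𝟙-≟ x

∑-const : ∀ n c → ∑[ i < n ] c ≡ n * c
∑-const zero    c = refl
∑-const (suc n) c = cong (c +_) (∑-const n c)

module _ {a} {A : Set a} {P : Pred A p} (P? : Decidable P) where

  length-filter-++ : ∀ xs ys →
    length (filter P? (xs ++ ys)) ≡ length (filter P? xs) + length (filter P? ys)
  length-filter-++ xs ys = trans (cong length (filter-++ P? xs ys)) (length-++ (filter P? xs))

  length-filter-tabulate : ∀ {n} (f : Fin n → A) →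
    length (filter P? (tabulate f)) ≡ ∑[ i < n ] 𝟙 (P? (f i))
  length-filter-tabulate {zero}  f = refl
  length-filter-tabulate {suc n} f with P? (f zero)
  ... | yes _ = cong suc (length-filter-tabulate (f ∘ suc))
  ... | no _  = length-filter-tabulate (f ∘ suc)

  length-filter-filter : ∀ {Q : Pred A q} (Q? : Decidable Q) xs →
    length (filter Q? (filter P? xs)) ≡ length (filter (λ x → P? x ×-dec Q? x) xs)
  length-filter-filter Q? [] = refl
  length-filter-filter Q? (x ∷ xs) with P? x
  ... | no _ = length-filter-filter Q? xs
  ... | yes _ with Q? x
  ...   | yes _ = cong suc (length-filter-filter Q? xs)
  ...   | no _  = length-filter-filter Q? xs

length-filter-cartesianProduct :
  ∀ {a b} {A : Set a} {B : Set b} {P : Pred (A × B) p} (P? : Decidable P) {m n}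
  (f : Fin m → A) (g : Fin n → B) →
  length (filter P? (cartesianProduct (tabulate f) (tabulate g)))
    ≡ ∑[ i < m ] ∑[ j < n ] 𝟙 (P? (f i , g j))
length-filter-cartesianProduct P? {zero}      f g = refl
length-filter-cartesianProduct P? {suc m} {n} f g = begin
  length (filter P? (map (f zero ,_) (tabulate g) ++ rest))
    ≡⟨ length-filter-++ P? (map (f zero ,_) (tabulate g)) rest ⟩
  length (filter P? (map (f zero ,_) (tabulate g))) + length (filter P? rest)
    ≡⟨ cong₂ _+_ (cong (length ∘ filter P?) (map-tabulate g (f zero ,_)))
                 (length-filter-cartesianProduct P? (f ∘ suc) g) ⟩
  length (filter P? (tabulate ((f zero ,_) ∘ g))) + ∑[ i < m ] ∑[ j < n ] 𝟙 (P? (f (suc i) , g j))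
    ≡⟨ cong (_+ _) (length-filter-tabulate P? ((f zero ,_) ∘ g)) ⟩
  ∑[ i < suc m ] ∑[ j < n ] 𝟙 (P? (f i , g j)) ∎
  where
  rest : List (_ × _)
  rest = cartesianProduct (tabulate (f ∘ suc)) (tabulate g)

∑∑-cong : ∀ {m n} {f g : Fin m → Fin n → ℕ} → (∀ i j → f i j ≡ g i j) →
  ∑[ i < m ] ∑[ j < n ] f i j ≡ ∑[ i < m ] ∑[ j < n ] g i j
∑∑-cong f≡g = sum-cong-≗ (λ i → sum-cong-≗ (f≡g i))

∑∑-comm : ∀ {m n k l} (f : Fin m → Fin n → Fin k → Fin l → ℕ) →
  ∑[ i < m ] ∑[ j < n ] ∑[ r < k ] ∑[ s < l ] f i j r s
    ≡ ∑[ r < k ] ∑[ s < l ] ∑[ i < m ] ∑[ j < n ] f i j r s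
∑∑-comm f = begin
  ∑[ i < _ ] ∑[ j < _ ] ∑[ r < _ ] ∑[ s < _ ] f i j r s
    ≡⟨ sum-cong-≗ (λ i → ∑-comm (λ j r → ∑[ s < _ ] f i j r s)) ⟩
  ∑[ i < _ ] ∑[ r < _ ] ∑[ j < _ ] ∑[ s < _ ] f i j r s
    ≡⟨ ∑-comm (λ i r → ∑[ j < _ ] ∑[ s < _ ] f i j r s) ⟩
  ∑[ r < _ ] ∑[ i < _ ] ∑[ j < _ ] ∑[ s < _ ] f i j r s
    ≡⟨ ∑∑-cong (λ r i → ∑-comm (λ j s → f i j r s)) ⟩
  ∑[ r < _ ] ∑[ i < _ ] ∑[ s < _ ] ∑[ j < _ ] f i j r s
    ≡⟨ sum-cong-≗ (λ r → ∑-comm (λ i s → ∑[ j < _ ] f i j r s)) ⟩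
  ∑[ r < _ ] ∑[ s < _ ] ∑[ i < _ ] ∑[ j < _ ] f i j r s ∎

*-distribˡ-∑∑ : ∀ {m n} x (f : Fin m → Fin n → ℕ) →
  x * ∑[ i < m ] ∑[ j < n ] f i j ≡ ∑[ i < m ] ∑[ j < n ] (x * f i j)
*-distribˡ-∑∑ {m} {n} x f =
  trans (*-distribˡ-sum x (λ i → ∑[ j < n ] f i j)) (sum-cong-≗ (λ i → *-distribˡ-sum x (f i)))

∑∑-distrib-+ : ∀ {m n} (f g : Fin m → Fin n → ℕ) →
  ∑[ i < m ] ∑[ j < n ] (f i j + g i j)
    ≡ ∑[ i < m ] ∑[ j < n ] f i j + ∑[ i < m ] ∑[ j < n ] g i j
∑∑-distrib-+ {m} {n} f g =
  trans (sum-cong-≗ (λ i → ∑-distrib-+ (f i) (g i)))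
        (∑-distrib-+ (λ i → ∑[ j < n ] f i j) (λ i → ∑[ j < n ] g i j))

module _ {k} (L : Fin (suc k) → Fin (suc k) → ℕ)
         (rows : ∀ a b b′ → L a b + L b a ≡ L a b′ + L b′ a) where

  symmetrized-constant : ∀ a b → L a b + L b a ≡ 2 * L zero zero
  symmetrized-constant a b = begin
    L a b + L b a             ≡⟨ rows a b zero ⟩
    L a zero + L zero a       ≡⟨ +-comm (L a zero) _ ⟩
    L zero a + L a zero       ≡⟨ rows zero a zero ⟩
    L zero zero + L zero zero ≡⟨ cong (L zero zero +_) (+-identityʳ _) ⟨
    2 * L zero zero           ∎

  diagonal-constant : ∀ a → L a a ≡ L zero zero
  diagonal-constant a = *-cancelˡ-≡ _ _ 2 (begin
    2 * L a a       ≡⟨ cong (L a a +_) (+-identityʳ _) ⟩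
    L a a + L a a   ≡⟨ symmetrized-constant a a ⟩
    2 * L zero zero ∎)

  total-constant : ∑[ a < suc k ] ∑[ b < suc k ] L a b ≡ (suc k * suc k) * L zero zero
  total-constant = *-cancelˡ-≡ _ _ 2 (begin
    2 * S
      ≡⟨ cong (S +_) (+-identityʳ S) ⟩
    S + S
      ≡⟨ cong (S +_) (∑-comm L) ⟩
    S + ∑[ a < suc k ] ∑[ b < suc k ] L b a
      ≡⟨ ∑∑-distrib-+ L (λ a b → L b a) ⟨
    ∑[ a < suc k ] ∑[ b < suc k ] (L a b + L b a)
      ≡⟨ ∑∑-cong symmetrized-constant ⟩
    ∑[ a < suc k ] ∑[ b < suc k ] (2 * h)
      ≡⟨ sum-cong-≗ {suc k} (λ _ → ∑-const (suc k) (2 * h)) ⟩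
    ∑[ a < suc k ] (suc k * (2 * h))
      ≡⟨ ∑-const (suc k) (suc k * (2 * h)) ⟩
    suc k * (suc k * (2 * h))
      ≡⟨ reassociate (suc k) h ⟩
    2 * ((suc k * suc k) * h) ∎)
    where
    h S : ℕ
    h = L zero zero
    S = ∑[ a < suc k ] ∑[ b < suc k ] L a b
    reassociate : ∀ m x → m * (m * (2 * x)) ≡ 2 * ((m * m) * x)
    reassociate = solve-∀

module _ {n} (G : SimpleGraph n) (ℓ : Coloring n) where

  adjacency : Fin n → Fin n → ℕ
  adjacency u v = 𝟙 (T? (adj G u v))

  isEdge? : ∀ u v → Dec (toℕ u < toℕ v × T (adj G u v))
  isEdge? u v = (toℕ u <? toℕ v) ×-dec T? (adj G u v)

  edgeIndicator : Fin n → Fin n → ℕ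
  edgeIndicator u v = 𝟙 (isEdge? u v)

  colorIndicator : Fin 3 → Fin n → ℕ
  colorIndicator a u = 𝟙 (ℓ u ≟ a)

  orientedEdgesBetween : Fin 3 → Fin 3 → ℕ
  orientedEdgesBetween a b =
    ∑[ u < n ] ∑[ v < n ] (edgeIndicator u v * (colorIndicator a u * colorIndicator b v))

  private
    E : Fin n → Fin n → ℕ
    E = edgeIndicator

    χ : Fin 3 → Fin n → ℕ
    χ = colorIndicator

  adjacency-split : ∀ u v → adjacency u v ≡ edgeIndicator u v + edgeIndicator v u
  adjacency-split u v = orient (toℕ u <? toℕ v) (toℕ v <? toℕ u)
    where
    orient : (u<? : Dec (toℕ u < toℕ v)) (v<? : Dec (toℕ v < toℕ u)) →
             adjacency u v ≡ 𝟙 (u<? ×-dec T? (adj G u v)) + 𝟙 (v<? ×-dec T? (adj G v u))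
    orient (yes u<v) (yes v<u) = ⊥-elim (<-asym u<v v<u)
    orient (yes _)   (no _)    = sym (+-identityʳ _)
    orient (no _)    (yes _)   = cong (𝟙 ∘ T?) (SimpleGraph.sym G u v)
    orient (no u≮v)  (no v≮u)  = cong (𝟙 ∘ T?) (trans (cong (adj G u) (sym u≡v)) (irrefl G u))
      where
      u≡v : u ≡ v
      u≡v = toℕ-injective (≤-antisym (≮⇒≥ v≮u) (≮⇒≥ u≮v))

  nbrCount-≡-∑ : ∀ u b → nbrCount G ℓ u b ≡ ∑[ v < n ] (adjacency u v * colorIndicator b v)
  nbrCount-≡-∑ u b =
    trans (length-filter-tabulate (λ w → T? (adj G u w) ×-dec (ℓ w ≟ b)) id)
          (sum-cong-≗ {n} (λ v → 𝟙-×-dec (T? (adj G u v)) (ℓ v ≟ b)))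

  color-handshake : ∀ a b →
    ∑[ u < n ] (colorIndicator a u * nbrCount G ℓ u b)
      ≡ orientedEdgesBetween a b + orientedEdgesBetween b a
  color-handshake a b = begin
    ∑[ u < n ] (χ a u * nbrCount G ℓ u b)
      ≡⟨ sum-cong-≗ (λ u → cong (χ a u *_) (nbrCount-≡-∑ u b)) ⟩
    ∑[ u < n ] (χ a u * ∑[ v < n ] (adjacency u v * χ b v))
      ≡⟨ sum-cong-≗ (λ u → *-distribˡ-sum (χ a u) (λ v → adjacency u v * χ b v)) ⟩
    ∑[ u < n ] ∑[ v < n ] (χ a u * (adjacency u v * χ b v))
      ≡⟨ ∑∑-cong split ⟩
    ∑[ u < n ] ∑[ v < n ] (E u v * (χ a u * χ b v) + E v u * (χ a u * χ b v))
      ≡⟨ ∑∑-distrib-+ (λ u v → E u v * (χ a u * χ b v)) (λ u v → E v u * (χ a u * χ b v)) ⟩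
    orientedEdgesBetween a b + ∑[ u < n ] ∑[ v < n ] (E v u * (χ a u * χ b v))
      ≡⟨ cong (orientedEdgesBetween a b +_) (∑-comm (λ u v → E v u * (χ a u * χ b v))) ⟩
    orientedEdgesBetween a b + ∑[ v < n ] ∑[ u < n ] (E v u * (χ a u * χ b v))
      ≡⟨ cong (orientedEdgesBetween a b +_)
              (∑∑-cong (λ v u → cong (E v u *_) (*-comm (χ a u) (χ b v)))) ⟩
    orientedEdgesBetween a b + orientedEdgesBetween b a ∎
    where
    split : ∀ u v →
      χ a u * (adjacency u v * χ b v) ≡ E u v * (χ a u * χ b v) + E v u * (χ a u * χ b v)
    split u v = begin
      χ a u * (adjacency u v * χ b v)   ≡⟨ x∙yz≈y∙xz (χ a u) (adjacency u v) (χ b v) ⟩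
      adjacency u v * (χ a u * χ b v)   ≡⟨ cong (_* (χ a u * χ b v)) (adjacency-split u v) ⟩
      (E u v + E v u) * (χ a u * χ b v) ≡⟨ *-distribʳ-+ (χ a u * χ b v) (E u v) (E v u) ⟩
      E u v * (χ a u * χ b v) + E v u * (χ a u * χ b v) ∎

  colorPairs-partition : ∀ u v →
    ∑[ a < 3 ] ∑[ b < 3 ] (colorIndicator a u * colorIndicator b v) ≡ 1
  colorPairs-partition u v = begin
    ∑[ a < 3 ] ∑[ b < 3 ] (χ a u * χ b v)
      ≡⟨ sum-cong-≗ (λ a → *-distribˡ-sum (χ a u) (λ b → χ b v)) ⟨
    ∑[ a < 3 ] (χ a u * ∑[ b < 3 ] χ b v)
      ≡⟨ sum-cong-≗ (λ a → cong (χ a u *_) (∑-𝟙-≟ (ℓ v))) ⟩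
    ∑[ a < 3 ] (χ a u * 1)
      ≡⟨ sum-cong-≗ (λ a → *-identityʳ (χ a u)) ⟩
    ∑[ a < 3 ] χ a u
      ≡⟨ ∑-𝟙-≟ (ℓ u) ⟩
    1 ∎

  numEdges-by-colors : numEdges G ≡ ∑[ a < 3 ] ∑[ b < 3 ] orientedEdgesBetween a b
  numEdges-by-colors = begin
    numEdges G
      ≡⟨ length-filter-cartesianProduct (uncurry isEdge?) id id ⟩
    ∑[ u < n ] ∑[ v < n ] E u v
      ≡⟨ ∑∑-cong refine ⟩
    ∑[ u < n ] ∑[ v < n ] ∑[ a < 3 ] ∑[ b < 3 ] (E u v * (χ a u * χ b v))
      ≡⟨ ∑∑-comm (λ u v a b → E u v * (χ a u * χ b v)) ⟩
    ∑[ a < 3 ] ∑[ b < 3 ] orientedEdgesBetween a b ∎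
    where
    refine : ∀ u v → E u v ≡ ∑[ a < 3 ] ∑[ b < 3 ] (E u v * (χ a u * χ b v))
    refine u v = begin
      E u v
        ≡⟨ *-identityʳ (E u v) ⟨
      E u v * 1
        ≡⟨ cong (E u v *_) (colorPairs-partition u v) ⟨
      E u v * ∑[ a < 3 ] ∑[ b < 3 ] (χ a u * χ b v)
        ≡⟨ *-distribˡ-∑∑ (E u v) (λ a b → χ a u * χ b v) ⟩
      ∑[ a < 3 ] ∑[ b < 3 ] (E u v * (χ a u * χ b v)) ∎

  endColors? : ∀ a b i j → Dec (EndColors a b i j)
  endColors? a b i j = ((a ≟ i) ×-dec (b ≟ j)) ⊎-dec ((a ≟ j) ×-dec (b ≟ i))

  numEdgesBetween-≡-∑ : ∀ i j → numEdgesBetween G ℓ i j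
    ≡ ∑[ u < n ] ∑[ v < n ] (edgeIndicator u v * 𝟙 (endColors? (ℓ u) (ℓ v) i j))
  numEdgesBetween-≡-∑ i j = begin
    numEdgesBetween G ℓ i j
      ≡⟨ length-filter-filter (uncurry isEdge?) (uncurry colors?) pairs ⟩
    length (filter (λ e → uncurry isEdge? e ×-dec uncurry colors? e) pairs)
      ≡⟨ length-filter-cartesianProduct (λ e → uncurry isEdge? e ×-dec uncurry colors? e) id id ⟩
    ∑[ u < n ] ∑[ v < n ] 𝟙 (isEdge? u v ×-dec colors? u v)
      ≡⟨ ∑∑-cong (λ u v → 𝟙-×-dec (isEdge? u v) (colors? u v)) ⟩
    ∑[ u < n ] ∑[ v < n ] (E u v * 𝟙 (colors? u v)) ∎
    where
    pairs : List (Fin n × Fin n)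
    pairs = cartesianProduct (allFin n) (allFin n)

    colors? : ∀ u v → Dec (EndColors (ℓ u) (ℓ v) i j)
    colors? u v = endColors? (ℓ u) (ℓ v) i j

  numEdgesBetween-distinct : ∀ {i j} → i ≢ j →
    numEdgesBetween G ℓ i j ≡ orientedEdgesBetween i j + orientedEdgesBetween j i
  numEdgesBetween-distinct {i} {j} i≢j = begin
    numEdgesBetween G ℓ i j
      ≡⟨ numEdgesBetween-≡-∑ i j ⟩
    ∑[ u < n ] ∑[ v < n ] (E u v * 𝟙 (endColors? (ℓ u) (ℓ v) i j))
      ≡⟨ ∑∑-cong (λ u v → cong (E u v *_) (colors u v)) ⟩
    ∑[ u < n ] ∑[ v < n ] (E u v * (χ i u * χ j v + χ j u * χ i v))
      ≡⟨ ∑∑-cong (λ u v → *-distribˡ-+ (E u v) (χ i u * χ j v) (χ j u * χ i v)) ⟩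
    ∑[ u < n ] ∑[ v < n ] (E u v * (χ i u * χ j v) + E u v * (χ j u * χ i v))
      ≡⟨ ∑∑-distrib-+ (λ u v → E u v * (χ i u * χ j v)) (λ u v → E u v * (χ j u * χ i v)) ⟩
    orientedEdgesBetween i j + orientedEdgesBetween j i ∎
    where
    colors : ∀ u v → 𝟙 (endColors? (ℓ u) (ℓ v) i j) ≡ χ i u * χ j v + χ j u * χ i v
    colors u v = begin
      𝟙 (endColors? (ℓ u) (ℓ v) i j)
        ≡⟨ 𝟙-⊎-dec ((ℓ u ≟ i) ×-dec (ℓ v ≟ j)) ((ℓ u ≟ j) ×-dec (ℓ v ≟ i))
                   (λ ((ℓu≡i , _) , (ℓu≡j , _)) → i≢j (trans (sym ℓu≡i) ℓu≡j)) ⟩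
      𝟙 ((ℓ u ≟ i) ×-dec (ℓ v ≟ j)) + 𝟙 ((ℓ u ≟ j) ×-dec (ℓ v ≟ i))
        ≡⟨ cong₂ _+_ (𝟙-×-dec (ℓ u ≟ i) (ℓ v ≟ j))
                     (𝟙-×-dec (ℓ u ≟ j) (ℓ v ≟ i)) ⟩
      χ i u * χ j v + χ j u * χ i v ∎

  numEdgesBetween-diagonal : ∀ i → numEdgesBetween G ℓ i i ≡ orientedEdgesBetween i i
  numEdgesBetween-diagonal i =
    trans (numEdgesBetween-≡-∑ i i) (∑∑-cong (λ u v → cong (E u v *_) (colors u v)))
    where
    colors : ∀ u v → 𝟙 (endColors? (ℓ u) (ℓ v) i i) ≡ χ i u * χ i v
    colors u v =
      trans (𝟙-⊎-dec-idem ((ℓ u ≟ i) ×-dec (ℓ v ≟ i))) (𝟙-×-dec (ℓ u ≟ i) (ℓ v ≟ i))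

  balanced⇒symmetrized-rows-constant : Balanced G ℓ → ∀ a b b′ →
    orientedEdgesBetween a b + orientedEdgesBetween b a
      ≡ orientedEdgesBetween a b′ + orientedEdgesBetween b′ a
  balanced⇒symmetrized-rows-constant balanced a b b′ = begin
    orientedEdgesBetween a b + orientedEdgesBetween b a
      ≡⟨ color-handshake a b ⟨
    ∑[ u < n ] (χ a u * nbrCount G ℓ u b)
      ≡⟨ sum-cong-≗ (λ u → cong (χ a u *_) (balanced u b b′)) ⟩
    ∑[ u < n ] (χ a u * nbrCount G ℓ u b′)
      ≡⟨ color-handshake a b′ ⟩
    orientedEdgesBetween a b′ + orientedEdgesBetween b′ a ∎

theorem3p2 : ∀ {n} (G : SimpleGraph n) (ℓ : Coloring n) → Balanced G ℓ →
    ((i j : Fin 3) → i ≢ j → 9 * numEdgesBetween G ℓ i j ≡ 2 * numEdges G)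
    × ((i : Fin 3) → 9 * numEdgesBetween G ℓ i i ≡ numEdges G)
    × (9 ∣ numEdges G)
theorem3p2 G ℓ balanced = distinct , diagonal , divides h (trans |E|≡9h (*-comm 9 h))
  where
  L : Fin 3 → Fin 3 → ℕ
  L = orientedEdgesBetween G ℓ

  rows : ∀ a b b′ → L a b + L b a ≡ L a b′ + L b′ a
  rows = balanced⇒symmetrized-rows-constant G ℓ balanced

  h : ℕ
  h = L zero zero

  |E|≡9h : numEdges G ≡ 9 * h
  |E|≡9h = trans (numEdges-by-colors G ℓ) (total-constant L rows)

  distinct : ∀ i j → i ≢ j → 9 * numEdgesBetween G ℓ i j ≡ 2 * numEdges G
  distinct i j i≢j = begin
    9 * numEdgesBetween G ℓ i j ≡⟨ cong (9 *_) (numEdgesBetween-distinct G ℓ i≢j) ⟩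
    9 * (L i j + L j i)         ≡⟨ cong (9 *_) (symmetrized-constant L rows i j) ⟩
    9 * (2 * h)                 ≡⟨ trans (sym (*-assoc 9 2 h)) (*-assoc 2 9 h) ⟩
    2 * (9 * h)                 ≡⟨ cong (2 *_) |E|≡9h ⟨
    2 * numEdges G              ∎

  diagonal : ∀ i → 9 * numEdgesBetween G ℓ i i ≡ numEdges G
  diagonal i = begin
    9 * numEdgesBetween G ℓ i i ≡⟨ cong (9 *_) (numEdgesBetween-diagonal G ℓ i) ⟩
    9 * L i i                   ≡⟨ cong (9 *_) (diagonal-constant L rows i) ⟩
    9 * h                       ≡⟨ |E|≡9h ⟨
    numEdges G                  ∎
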